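{- Let $n$ be sufficiently large, and let $x=\sum_{k\in\mathbb Z}c_k\pi_K^k\in\mathbb A_K^{\dagger,n}$ ($c_k\in\mathbb Z_p$). Then its formal derivative $x'=\frac{dx}{d\pi_K}=\sum_{k\in\mathbb Z}kc_k\pi_K^{k-1}$ also lies in $\mathbb A_K^{\dagger,n}$.
   Context: Let $p>2$ be prime and $K$ a finite totally ramified extension of $\mathbb Q_p$ with $e=[K:\mathbb Q_p]$ and $K\cap\mathbb Q_p(\mu_{p^\infty})=\mathbb Q_p$. There exist $n(K)\in\mathbb N$ and a lift $\pi_K\in\mathbb A_K$ (Fontaine's ring of $K$) of a uniformizer of the field of norms of $K(\mu_{p^\infty})$ such that for $n\ge n(K)$ the overconvergent ring $\mathbb A_K^{\dagger,n}$ consists exactly of the series $\sum_{k\in\mathbb Z}c_k\pi_K^k$ with $c_k\in\mathbb Z_p$ which are analytic and bounded by $1$ on $\{p^{ -1/(e(p-1)p^{n-1})}\le|X|<1\}$, equivalently with $v_p(c_k)+\frac{k}{(p-1)ep^{n-1}}\ge0$ for all $k<0$ and $\to+\infty$ as $k\to-\infty$. -}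

module Defs where

open import Data.Nat as ℕ using (ℕ; suc; _^_; _∸_)
open import Data.Integer as ℤ using (ℤ; +_; -_; _-_; _*_)
open import Data.Integer.Properties using (*-distribˡ-+; neg-distribʳ-*)
open import Data.Integer.Divisibility.Signed using (_∣_; ∣n⇒∣m*n)
open import Data.Rational.Unnormalised as Q using (ℚᵘ; mkℚᵘ; _/_)
open import Data.Product using (∃; _×_)
open import Relation.Binary.PropositionalEquality
  using (_≡_; subst; sym; cong; trans)

-- p-adic integers ℤ_p, as compatible sequences of integers:
-- seq m approximates the element modulo p^m, and
-- seq (m+1) ≡ seq m (mod p^m).  Two representatives denote the same
-- element iff they agree mod p^m for every m; all predicates below
-- respect this equivalence.

record ℤₚ (p : ℕ) : Set where
  field
    seq    : ℕ → ℤ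
    compat : ∀ m → (+ (p ^ m)) ∣ (seq (suc m) - seq m)
open ℤₚ public

ValGeℕ : ∀ {p} → ℕ → ℤₚ p → Set
ValGeℕ {p} m c = (+ (p ^ m)) ∣ seq c m

-- v_p(c) ≥ q for rational q (with v_p(0) = +∞): since v_p(c) is an
-- integer or +∞, this means v_p(c) ≥ m for every natural m with
-- m < q + 1 (i.e. for every natural m ≤ ⌈q⌉).
ValGe : ∀ {p} → ℚᵘ → ℤₚ p → Set
ValGe q c = ∀ m → (+ m / 1) Q.< (q Q.+ Q.1ℚᵘ) → ValGeℕ m c

_·ₚ_ : ∀ {p} → ℤ → ℤₚ p → ℤₚ p
_·ₚ_ {p} k c = record { seq = λ m → k * seq c m ; compat = pf }
  where
  pf : ∀ m → (+ (p ^ m)) ∣ (k * seq c (suc m) - k * seq c m)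
  pf m = subst (λ z → (+ (p ^ m)) ∣ z) eq (∣n⇒∣m*n k (compat c m))
    where
    eq : k * (seq c (suc m) - seq c m) ≡ k * seq c (suc m) - k * seq c m
    eq = trans (*-distribˡ-+ k (seq c (suc m)) (- seq c m))
               (cong (λ z → k * seq c (suc m) ℤ.+ z)
                     (sym (neg-distribʳ-* k (seq c m))))

-- Formal Laurent series Σ_{k∈ℤ} c_k π_K^k with coefficients in ℤ_p,
-- given by their coefficient family.

Laurent : ℕ → Set
Laurent p = ℤ → ℤₚ p

deriv : ∀ {p} → Laurent p → Laurent p
deriv c k = (k ℤ.+ + 1) ·ₚ c (k ℤ.+ + 1)

den : (p e n : ℕ) → ℕ
den p e n = (p ∸ 1) ℕ.* e ℕ.* p ^ (n ∸ 1)

-- the rational number k / ((p-1) e p^(n-1)).  (den p e n ≥ 1 whenever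
-- p ≥ 2 and e ≥ 1, in which case this is exactly k / den.)
ratio : (p e n : ℕ) → ℤ → ℚᵘ
ratio p e n k = mkℚᵘ k (den p e n ∸ 1)

-- Membership in 𝔸_K^{†,n} (for n ≥ n(K)), via the description in the
-- context: x = Σ c_k π_K^k with c_k ∈ ℤ_p,
--   v_p(c_k) + k/((p-1)e p^(n-1)) ≥ 0  for all k < 0, and
--   v_p(c_k) + k/((p-1)e p^(n-1)) → +∞ as k → -∞.
InDagger : (p e n : ℕ) → Laurent p → Set
InDagger p e n c =
  (∀ k → k ℤ.< + 0 → ValGe (Q.- ratio p e n k) (c k))
  × (∀ (M : ℕ) → ∃ λ (N : ℕ) → ∀ k → k ℤ.< - (+ N) →
       ValGe ((+ M / 1) Q.- ratio p e n k) (c k))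

{-# OPTIONS --safe #-}
module Submission where

-- Write D = (p-1)e p^(n-1) and d = D - 1.  The coefficient of π^k in x' is
-- (k+1)c_{k+1}.  For k < 0 the hypothesis gives v(c_{k+1}) ≥ (-k-1)/D, and
-- since valuations are integers this already implies v ≥ -k/D unless D
-- divides k+1; in that case n ≥ 2 gives p ∣ D ∣ k+1, and the factor k+1
-- adds the missing unit of valuation.  For the decay condition, shifting the
-- index by one costs 1 - 1/D < 1 in the bound, which is absorbed by asking
-- for M + 1 instead of M.

open import Defs
open import Data.Nat as ℕ using (ℕ; _≥_; _>_; zero; suc; _∸_; _^_; s≤s)
open import Data.Nat.Primality using (Prime)
import Data.Nat.Properties as ℕ
import Data.Nat.Divisibility as ℕ
open import Data.Integer as ℤ using (ℤ; +_; -[1+_]; -_; _-_; +<+; -<+)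
import Data.Integer.Properties as ℤ
import Data.Integer.Divisibility.Signed as ℤ
open import Data.Integer.Solver using (module +-*-Solver)
open import Data.Rational.Unnormalised as ℚ using (mkℚᵘ; _/_; *<*; *≤*)
import Data.Rational.Unnormalised.Properties as ℚ
open import Data.Product using (∃; _,_)
open import Data.Sum using (inj₁; inj₂)
open import Data.Empty using (⊥-elim)
open import Function.Bundles using (_⇔_; mk⇔; Equivalence)
open import Relation.Binary.PropositionalEquality

ValGe-antitone : ∀ {p q r} (c : ℤₚ p) → q ℚ.≤ r → ValGe r c → ValGe q c
ValGe-antitone c q≤r h m m<q+1 = h m (ℚ.<-≤-trans m<q+1 (ℚ.+-monoˡ-≤ ℚ.1ℚᵘ q≤r))

ValGe-·ₚ : ∀ {p q} k (c : ℤₚ p) → ValGe q c → ValGe q (k ·ₚ c)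
ValGe-·ₚ k c h m m<q+1 = ℤ.∣n⇒∣m*n k (h m m<q+1)

ValGe-0·ₚ : ∀ {p} q (c : ℤₚ p) → ValGe q ((+ 0) ·ₚ c)
ValGe-0·ₚ q c m _ = ℤ.divides (+ 0) refl

ValGeℕ⇒∣seq-suc : ∀ {p m} (c : ℤₚ p) →
  ValGeℕ m c → (+ (p ^ m)) ℤ.∣ seq c (suc m)
ValGeℕ⇒∣seq-suc {m = m} c h =
  subst (_ ℤ.∣_) (x-y+y≡x (seq c (suc m)) (seq c m)) (ℤ.∣m∣n⇒∣m+n (compat c m) h)
  where
  open +-*-Solver
  x-y+y≡x : ∀ x y → (x - y) ℤ.+ y ≡ x
  x-y+y≡x = solve 2 (λ x y → (x :- y) :+ y := x) refl

ValGeℕ-suc-·ₚ : ∀ {p m k} (c : ℤₚ p) →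
  (+ p) ℤ.∣ k → ValGeℕ m c → ValGeℕ (suc m) (k ·ₚ c)
ValGeℕ-suc-·ₚ {p} {m} {k} c p∣k h =
  subst (ℤ._∣ k ℤ.* seq c (suc m)) (sym (ℤ.pos-* p (p ^ m)))
    (ℤ.∣-trans (ℤ.*-monoˡ-∣ (+ (p ^ m)) p∣k) (ℤ.*-monoʳ-∣ k (ValGeℕ⇒∣seq-suc c h)))

-- v_p(c) ≥ j/(d+1); the denominator is offset by one as in mkℚᵘ.
ValGeFrac : ∀ {p} → ℕ → ℕ → ℤₚ p → Set
ValGeFrac j d c = ∀ m → m ℕ.* suc d ℕ.< j ℕ.+ suc d → ValGeℕ m c

<-mkℚᵘ+1⇔ : ∀ m j d →
  (+ m / 1) ℚ.< mkℚᵘ (+ j) d ℚ.+ ℚ.1ℚᵘ ⇔ m ℕ.* suc d ℕ.< j ℕ.+ suc d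
<-mkℚᵘ+1⇔ m j d = mk⇔
  (λ { (*<* lt) → ℤ.drop‿+<+ (subst₂ ℤ._<_ lhs rhs lt) })
  (λ lt → *<* (subst₂ ℤ._<_ (sym lhs) (sym rhs) (+<+ lt)))
  where
  open +-*-Solver
  lhs : + m ℤ.* + suc (d ℕ.* 1) ≡ + (m ℕ.* suc d)
  lhs = trans (cong (λ z → + m ℤ.* + suc z) (ℕ.*-identityʳ d))
              (sym (ℤ.pos-* m (suc d)))
  rhs : (+ j ℤ.* + 1 ℤ.+ + 1 ℤ.* + suc d) ℤ.* + 1 ≡ + j ℤ.+ + suc d
  rhs = solve 2 (λ j D → (j :* con (+ 1) :+ con (+ 1) :* D) :* con (+ 1) := j :+ D)
    refl (+ j) (+ suc d)

ValGe⇔ValGeFrac : ∀ {p} j d (c : ℤₚ p) → ValGe (mkℚᵘ (+ j) d) c ⇔ ValGeFrac j d c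
ValGe⇔ValGeFrac j d c = mk⇔
  (λ h m lt → h m (Equivalence.from (<-mkℚᵘ+1⇔ m j d) lt))
  (λ h m lt → h m (Equivalence.to (<-mkℚᵘ+1⇔ m j d) lt))

ValGeFrac-suc-·ₚ : ∀ {p j d} (c : ℤₚ p) → p ℕ.∣ suc d →
  ValGeFrac j d c → ValGeFrac (suc j) d ((- + j) ·ₚ c)
ValGeFrac-suc-·ₚ {p} {j} {d} c p∣D h m m*D<1+j+D
  with ℕ.m≤n⇒m<n∨m≡n (ℕ.s≤s⁻¹ m*D<1+j+D)
... | inj₁ m*D<j+D = ℤ.∣n⇒∣m*n (- + j) (h m m*D<j+D)
... | inj₂ m*D≡j+D = boundary m m*D≡j+D
  where
  -- The bound j/D is then the integer m - 1, so D ∣ j, hence p ∣ j,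
  -- and the factor j supplies the missing unit of valuation.
  boundary : ∀ m → m ℕ.* suc d ≡ j ℕ.+ suc d → ValGeℕ m ((- + j) ·ₚ c)
  boundary zero 0≡j+D = ⊥-elim (ℕ.0≢1+n (trans 0≡j+D (ℕ.+-suc j d)))
  boundary (suc m) 1+m*D≡j+D = ValGeℕ-suc-·ₚ c p∣-j (h m m*D<j+D)
    where
    m*D≡j : m ℕ.* suc d ≡ j
    m*D≡j = ℕ.+-cancelˡ-≡ (suc d) _ _ (trans 1+m*D≡j+D (ℕ.+-comm j (suc d)))
    p∣-j : (+ p) ℤ.∣ - + j
    p∣-j = ℤ.∣m⇒∣-m (ℤ.∣ᵤ⇒∣ (ℕ.∣-trans p∣D (ℕ.divides m (sym m*D≡j))))
    m*D<j+D : m ℕ.* suc d ℕ.< j ℕ.+ suc d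
    m*D<j+D = subst (ℕ._< j ℕ.+ suc d) (sym m*D≡j) (ℕ.m<m+n j ℕ.z<s)

mkℚᵘ-monoˡ-≤ : ∀ {a b} d → a ℤ.≤ b → mkℚᵘ a d ℚ.≤ mkℚᵘ b d
mkℚᵘ-monoˡ-≤ d a≤b = *≤* (ℤ.*-monoʳ-≤-nonNeg (+ suc d) a≤b)

-- Both sides normalise to fractions with denominator suc (d + 0) and
-- numerators a and a′ below.
M-k/D≤1+M-[k+1]/D : ∀ M d k →
  (+ M / 1) ℚ.- mkℚᵘ k d ℚ.≤ (+ suc M / 1) ℚ.- mkℚᵘ (k ℤ.+ + 1) d
M-k/D≤1+M-[k+1]/D M d k =
  mkℚᵘ-monoˡ-≤ {a} {a′} (d ℕ.+ 0) (subst (a ℤ.≤_) a+d≡a′ (ℤ.i≤i+j a (+ d)))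
  where
  open +-*-Solver
  a a′ : ℤ
  a = + M ℤ.* + suc d ℤ.+ (- k) ℤ.* + 1
  a′ = + suc M ℤ.* + suc d ℤ.+ (- (k ℤ.+ + 1)) ℤ.* + 1
  a+d≡a′ : a ℤ.+ + d ≡ a′
  a+d≡a′ = solve 3
    (λ M d k → (M :* (con (+ 1) :+ d) :+ (:- k) :* con (+ 1)) :+ d
            := (con (+ 1) :+ M) :* (con (+ 1) :+ d) :+ (:- (k :+ con (+ 1))) :* con (+ 1))
    refl (+ M) (+ d) k

-- InDagger p e n is TailBound d × TailDecay d with d = den p e n ∸ 1.
TailBound : ∀ {p} → ℕ → Laurent p → Set
TailBound d c = ∀ k → k ℤ.< + 0 → ValGe (ℚ.- mkℚᵘ k d) (c k)

TailDecay : ∀ {p} → ℕ → Laurent p → Set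
TailDecay d c = ∀ (M : ℕ) → ∃ λ (N : ℕ) → ∀ k → k ℤ.< - (+ N) →
  ValGe ((+ M / 1) ℚ.- mkℚᵘ k d) (c k)

deriv-TailBound : ∀ {p d} (c : Laurent p) → p ℕ.∣ suc d →
  TailBound d c → TailBound d (deriv c)
deriv-TailBound c p∣D bound (+ _) (+<+ ())
deriv-TailBound {d = d} c p∣D bound -[1+ 0 ] _ =
  ValGe-0·ₚ (mkℚᵘ (+ 1) d) (c (+ 0))
deriv-TailBound {d = d} c p∣D bound -[1+ suc t ] _ =
  Equivalence.from (ValGe⇔ValGeFrac (suc (suc t)) d (-[1+ t ] ·ₚ c -[1+ t ]))
    (ValGeFrac-suc-·ₚ (c -[1+ t ]) p∣D
      (Equivalence.to (ValGe⇔ValGeFrac (suc t) d (c -[1+ t ])) (bound -[1+ t ] -<+)))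

k<-[1+N]⇒k+1<-N : ∀ {k} N → k ℤ.< -[1+ N ] → k ℤ.+ + 1 ℤ.< - (+ N)
k<-[1+N]⇒k+1<-N {k} N k<-[1+N] =
  subst (k ℤ.+ + 1 ℤ.<_) (-[1+N]+1≡-N N) (ℤ.+-monoˡ-< (+ 1) k<-[1+N])
  where
  -[1+N]+1≡-N : ∀ N → -[1+ N ] ℤ.+ + 1 ≡ - (+ N)
  -[1+N]+1≡-N zero = refl
  -[1+N]+1≡-N (suc N) = refl

deriv-TailDecay : ∀ {p d} (c : Laurent p) → TailDecay d c → TailDecay d (deriv c)
deriv-TailDecay {d = d} c decay M with decay (suc M)
... | N , decayN = suc N , λ k k<-[1+N] →
  ValGe-·ₚ {q = (+ M / 1) ℚ.- mkℚᵘ k d} (k ℤ.+ + 1) (c (k ℤ.+ + 1))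
    (ValGe-antitone (c (k ℤ.+ + 1)) (M-k/D≤1+M-[k+1]/D M d k)
      (decayN (k ℤ.+ + 1) (k<-[1+N]⇒k+1<-N N k<-[1+N])))

p∣suc[den∸1] : ∀ {p e n} → p ≥ 2 → e ≥ 1 → n ≥ 2 → p ℕ.∣ suc (den p e n ∸ 1)
p∣suc[den∸1] {p} {e} {suc (suc r)} (s≤s (s≤s _)) (s≤s _) (s≤s (s≤s _)) =
  subst (p ℕ.∣_) (sym (ℕ.m+[n∸m]≡n den>0)) p∣den
  where
  p∣den : p ℕ.∣ den p e (2 ℕ.+ r)
  p∣den = ℕ.∣n⇒∣m*n ((p ∸ 1) ℕ.* e) (ℕ.∣m⇒∣m*n (p ^ r) ℕ.∣-refl)
  den>0 : 0 ℕ.< den p e (2 ℕ.+ r)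
  den>0 = ℕ.*-mono-< (ℕ.>-nonZero⁻¹ ((p ∸ 1) ℕ.* e)) (ℕ.m^n>0 p (suc r))

mainTheorem8 : (p e : ℕ) → Prime p → p > 2 → e ≥ 1 →
    ∃ λ (N : ℕ) → ∀ (n : ℕ) → n ≥ N →
    ∀ (x : Laurent p) → InDagger p e n x → InDagger p e n (deriv x)
mainTheorem8 p e _ p>2 e≥1 = 2 , λ n n≥2 x (bound , decay) →
  deriv-TailBound x (p∣suc[den∸1] (ℕ.<⇒≤ p>2) e≥1 n≥2) bound , deriv-TailDecay x decay
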